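{- For every positive integer $n$, $s(2^n) > \log_4 n$, where $s(N)$ denotes the sum of the decimal digits of $N$. In particular, $\lim_{n\to\infty} s(2^n) = \infty$.
   Context: For a positive integer $N$, $s(N)$ denotes the sum of the digits of $N$ written in base 10. -}

module Defs where

open import Data.Nat using (ℕ)
open import Data.Nat.ListAction using (sum)
open import Data.Digit using (toNatDigits)

s : ℕ → ℕ
s N = sum (toNatDigits 10 N)

{-# OPTIONS --safe #-}
-- If 2 ^ 4 ^ (m + 1) divides x and 5 does not, cut x at T = 10 ^ 4 ^ m. The low part x % T is
-- still divisible by 2 ^ 4 ^ m (which divides T) and not by 5 (which divides T), so by
-- induction its digits sum to more than m; the high part x / T is nonzero because
-- x ≥ 2 ^ 4 ^ (m + 1) = 16 ^ 4 ^ m ≥ T, so its digits add at least one more. For x = 2 ^ n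
-- this gives s (2 ^ n) > m whenever 4 ^ m ≤ n.
module Submission where

open import Defs
open import Data.Nat using (ℕ; _^_; _<_; _≤_; _≥_)
open import Data.Product using (_×_; ∃-syntax; _,_)

open import Data.Bool.Base using (true; false)
open import Data.Digit using (toNatDigits)
open import Data.List.Base using (List; []; _∷_)
open import Data.Nat.Base using (zero; suc; _>_; _+_; _*_; _∸_; _%_; _/_; _<ᵇ_; NonZero; >-nonZero; z<s; sz<ss)
open import Data.Nat.Coprimality using (Coprime; coprime?; coprime-divisor)
open import Data.Nat.Divisibility
open import Data.Nat.DivMod
open import Data.Nat.Induction using (<-wellFounded; <-wellFounded-fast)
open import Data.Nat.ListAction using (sum)
open import Data.Nat.Properties
open import Data.Unit.Base using (⊤; tt)
open import Function.Base using (_∘_)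
open import Induction.WellFounded using (Acc; acc)
open import Relation.Binary.PropositionalEquality
open import Relation.Nullary using (¬_; yes; no; contradiction)
open import Relation.Nullary.Decidable using (from-yes; from-no)

DigitLoop : Set
DigitLoop = ℕ → {m : ℕ} → Acc _<_ m → List ℕ → List ℕ

-- toNatDigits 10 runs an accumulator loop bound in an anonymous where-block, which cannot be
-- named. Unfolding toNatDigits 10 n once and abstracting every argument of the loop into a
-- variable lets unification solve the metavariable in the type of exposeLoop with that loop.
private
  data Loop (L : DigitLoop) : Set where
    loop : Loop L

  matchLoop : {L : DigitLoop} → Loop L → (o : ℕ) {m : ℕ} (a : Acc _<_ m) (ys : List ℕ) →
              L o a ys ≡ L o a ys → ⊤
  matchLoop _ _ _ _ _ = tt

  exposeLoop : Loop _ → (n : ℕ) → toNatDigits 10 n ≡ toNatDigits 10 n → ⊤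
  exposeLoop l n e with <-wellFounded-fast n
  exposeLoop l zero    e | _ = tt
  exposeLoop l (suc k) e | acc wf with 0 <ᵇ suc k / 10
  ... | false = tt
  ... | true with suc k / 10 | wf (m/n<m (suc k) 10 sz<ss) | suc k % 10 ∷ []
  ... | m | a | ys with suc k
  ... | o = matchLoop l o a ys e

  loopOf : {L : DigitLoop} → (Loop L → (n : ℕ) → toNatDigits 10 n ≡ toNatDigits 10 n → ⊤) → DigitLoop
  loopOf {L} _ = L

digitLoop : DigitLoop
digitLoop = loopOf exposeLoop

sum-digitLoop : ∀ o o′ {m} (a b : Acc _<_ m) xs →
                sum (digitLoop o a xs) ≡ sum (digitLoop o′ b []) + sum xs
sum-digitLoop o o′ {zero}  _        _         xs = refl
sum-digitLoop o o′ {suc k} (acc wf) (acc wf′) xs with 0 <ᵇ suc k / 10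
... | false = cong (_+ sum xs) (sym (+-identityʳ (suc k % 10)))
... | true = begin
  sum (digitLoop o (wf p) (d ∷ xs))            ≡⟨ sum-digitLoop o o′ (wf p) (wf′ p) (d ∷ xs) ⟩
  S + (d + sum xs)                             ≡⟨ +-assoc S d (sum xs) ⟨
  S + d + sum xs                               ≡⟨ cong (λ t → S + t + sum xs) (+-identityʳ d) ⟨
  S + (d + 0) + sum xs                         ≡⟨ cong (_+ sum xs) (sum-digitLoop o′ o′ (wf′ p) (wf′ p) (d ∷ [])) ⟨
  sum (digitLoop o′ (wf′ p) (d ∷ [])) + sum xs ∎
  where
  open ≡-Reasoning
  d = suc k % 10
  p = m/n<m (suc k) 10 sz<ss
  S = sum (digitLoop o′ (wf′ p) [])

0≮ᵇ⇒≡0 : ∀ n → (0 <ᵇ n) ≡ false → n ≡ 0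
0≮ᵇ⇒≡0 zero _ = refl

s[n]≡n%10+s[n/10] : ∀ n → s n ≡ n % 10 + s (n / 10)
s[n]≡n%10+s[n/10] zero = refl
s[n]≡n%10+s[n/10] n@(suc _) with 0 <ᵇ n / 10 in n/10>0
... | false = sym (cong (λ q → n % 10 + s q) (0≮ᵇ⇒≡0 (n / 10) n/10>0))
... | true  = trans (sum-digitLoop n (n / 10) _ (<-wellFounded-fast (n / 10)) (n % 10 ∷ []))
                    (trans (+-comm (s (n / 10)) (n % 10 + 0)) (cong (_+ s (n / 10)) (+-identityʳ (n % 10))))

n>0⇒s[n]>0 : ∀ {n} → n > 0 → s n > 0
n>0⇒s[n]>0 = go (<-wellFounded _)
  where
  open ≤-Reasoning
  go : ∀ {n} → Acc _<_ n → n > 0 → s n > 0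
  go {n@(suc _)} (acc rec) n>0 with n <? 10
  ... | yes n<10 = begin-strict
    0                   <⟨ n>0 ⟩
    n                   ≡⟨ m<n⇒m%n≡m n<10 ⟨
    n % 10              ≤⟨ m≤m+n (n % 10) (s (n / 10)) ⟩
    n % 10 + s (n / 10) ≡⟨ s[n]≡n%10+s[n/10] n ⟨
    s n                 ∎
  ... | no n≮10 = begin-strict
    0                   <⟨ go (rec (m/n<m n 10 sz<ss)) (m≥n⇒m/n>0 (≮⇒≥ n≮10)) ⟩
    s (n / 10)          ≤⟨ m≤n+m (s (n / 10)) (n % 10) ⟩
    n % 10 + s (n / 10) ≡⟨ s[n]≡n%10+s[n/10] n ⟨
    s n                 ∎

s[x]≡s[x%10^k]+s[x/10^k] : ∀ k x .{{_ : NonZero (10 ^ k)}} → s x ≡ s (x % 10 ^ k) + s (x / 10 ^ k)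
s[x]≡s[x%10^k]+s[x/10^k] zero x rewrite n%1≡0 x | n/1≡n x = refl
s[x]≡s[x%10^k]+s[x/10^k] (suc k) x = begin
  s x                                        ≡⟨ s[n]≡n%10+s[n/10] x ⟩
  x % 10 + s (x / 10)                        ≡⟨ cong (x % 10 +_) (s[x]≡s[x%10^k]+s[x/10^k] k (x / 10)) ⟩
  x % 10 + (s (x / 10 % T) + s (x / 10 / T)) ≡⟨ +-assoc (x % 10) _ _ ⟨
  x % 10 + s (x / 10 % T) + s (x / 10 / T)   ≡⟨ cong₂ _+_ low high ⟩
  s (x % (10 * T)) + s (x / (10 * T))        ∎
  where
  open ≡-Reasoning
  T = 10 ^ k
  instance
    T≢0 : NonZero T
    T≢0 = m^n≢0 10 k
    T*10≢0 : NonZero (T * 10)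
    T*10≢0 = m*n≢0 T 10
  low : x % 10 + s (x / 10 % T) ≡ s (x % (10 * T))
  low = begin
    x % 10 + s (x / 10 % T)                   ≡⟨ cong₂ (λ r q → r + s q) (m∣n⇒o%n%m≡o%m 10 (10 * T) x (m∣m*n T))
                                                                         (m%[n*o]/o≡m/o%n x T 10) ⟨
    x % (10 * T) % 10 + s (x % (T * 10) / 10) ≡⟨ cong (λ r → x % (10 * T) % 10 + s (r / 10)) (%-congʳ (*-comm T 10)) ⟩
    x % (10 * T) % 10 + s (x % (10 * T) / 10) ≡⟨ s[n]≡n%10+s[n/10] (x % (10 * T)) ⟨
    s (x % (10 * T))                          ∎
  high : s (x / 10 / T) ≡ s (x / (10 * T))
  high = cong s (m/n/o≡m/[n*o] x 10 T)

^-monoʳ-∣ : ∀ m {i j} → i ≤ j → m ^ i ∣ m ^ j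
^-monoʳ-∣ m {i} {j} i≤j = subst (m ^ i ∣_) m^i*m^[j∸i]≡m^j (m∣m*n (m ^ (j ∸ i)))
  where
  m^i*m^[j∸i]≡m^j : m ^ i * m ^ (j ∸ i) ≡ m ^ j
  m^i*m^[j∸i]≡m^j = trans (sym (^-distribˡ-+-* m i (j ∸ i))) (cong (m ^_) (m+[n∸m]≡n i≤j))

^-monoˡ-∣ : ∀ {d n} k → d ∣ n → d ^ k ∣ n ^ k
^-monoˡ-∣ zero    _   = ∣-refl
^-monoˡ-∣ (suc k) d∣n = *-pres-∣ d∣n (^-monoˡ-∣ k d∣n)

∣⇒∣^ : ∀ {d n} → d ∣ n → ∀ k .{{_ : NonZero k}} → d ∣ n ^ k
∣⇒∣^ {n = n} d∣n (suc k) = ∣m⇒∣m*n (n ^ k) d∣n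

coprime⇒∤^ : ∀ {d n} → Coprime d n → ¬ d ∣ 1 → ∀ k → ¬ d ∣ n ^ k
coprime⇒∤^ _   d∤1 zero    = d∤1
coprime⇒∤^ d⊥n d∤1 (suc k) = coprime⇒∤^ d⊥n d∤1 k ∘ coprime-divisor d⊥n

5∤2^ : ∀ n → ¬ 5 ∣ 2 ^ n
5∤2^ = coprime⇒∤^ (from-yes (coprime? 5 2)) (from-no (5 ∣? 1))

∤⇒>0 : ∀ {d n} → ¬ d ∣ n → n > 0
∤⇒>0 {d} {zero}  d∤0 = contradiction (d ∣0) d∤0
∤⇒>0 {n = suc _} _   = z<s

2^4^m∣x∧5∤x⇒m<s[x] : ∀ m {x} → 2 ^ 4 ^ m ∣ x → ¬ 5 ∣ x → m < s x
2^4^m∣x∧5∤x⇒m<s[x] zero        _      5∤x = n>0⇒s[n]>0 (∤⇒>0 5∤x)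
2^4^m∣x∧5∤x⇒m<s[x] (suc m) {x} 2^4K∣x 5∤x = begin-strict
  suc m                 ≤⟨ 2^4^m∣x∧5∤x⇒m<s[x] m 2^K∣x%T 5∤x%T ⟩
  s (x % T)             <⟨ m<m+n (s (x % T)) (n>0⇒s[n]>0 (m≥n⇒m/n>0 T≤x)) ⟩
  s (x % T) + s (x / T) ≡⟨ s[x]≡s[x%10^k]+s[x/10^k] K x ⟨
  s x                   ∎
  where
  open ≤-Reasoning
  K = 4 ^ m
  T = 10 ^ K
  instance
    K≢0 : NonZero K
    K≢0 = m^n≢0 4 m
    T≢0 : NonZero T
    T≢0 = m^n≢0 10 K
    x≢0 : NonZero x
    x≢0 = >-nonZero (∤⇒>0 5∤x)
  2^K∣x%T : 2 ^ K ∣ x % T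
  2^K∣x%T = %-presˡ-∣ (∣-trans (^-monoʳ-∣ 2 (m≤n*m K 4)) 2^4K∣x) (^-monoˡ-∣ K (divides 5 refl))
  5∤x%T : ¬ 5 ∣ x % T
  5∤x%T = 5∤x ∘ ∣n∣m%n⇒∣m (∣⇒∣^ (divides 2 refl) K)
  T≤x : T ≤ x
  T≤x = begin
    10 ^ K      ≤⟨ ^-monoˡ-≤ K (m≤m+n 10 6) ⟩
    16 ^ K      ≡⟨ ^-*-assoc 2 4 K ⟩
    2 ^ (4 * K) ≤⟨ ∣⇒≤ 2^4K∣x ⟩
    x           ∎

m<s[2^n] : ∀ {m n} → 4 ^ m ≤ n → m < s (2 ^ n)
m<s[2^n] {m} {n} 4^m≤n = 2^4^m∣x∧5∤x⇒m<s[x] m (^-monoʳ-∣ 2 4^m≤n) (5∤2^ n)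

mainTheorem1 : ((n : ℕ) → 1 ≤ n → n < 4 ^ s (2 ^ n))
    × ((M : ℕ) → ∃[ N ] ((n : ℕ) → n ≥ N → s (2 ^ n) ≥ M))
mainTheorem1 = (λ n _ → ≰⇒> (<-irrefl refl ∘ m<s[2^n]))
             , (λ M → 4 ^ M , λ _ → <⇒≤ ∘ m<s[2^n])
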